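{- Let $G=(A\cup B,E)$ be a marriage instance with critical set $C\subseteq A$, and let $M$ be a popular feasible matching of $G$. Then no vertex of $G$ belongs to both a size increasing alternating path (SIAP) and a size reducing alternating path (SRAP) with respect to $M$, where levels are those assigned to $M$ by the leveling procedure described in the context.
   Context: A marriage instance is a bipartite graph $G=(A\cup B,E)$ ($A$ men, $B$ women) with strict preference lists; every vertex prefers being matched to any neighbour over being unmatched. For matchings $M,N$, $\phi(N,M)$ is the number of vertices preferring $N$ to $M$. A matching is feasible if it matches all of $C$; a popular feasible matching is a feasible $M$ with $\phi(N,M)\le\phi(M,N)$ for all feasible $N$. Edge labels: for an edge $(u,v)\notin M$, $u$ gives label $+1$ if $u$ prefers $v$ to $M(u)$ (an unmatched vertex prefers any neighbour) and $-1$ otherwise; the label is written (man's label, woman's label). An alternating path with respect to $M$ is a path whose edges alternate between $M$ and $E\setminus M$. Leveling procedure applied to $M$: initially every vertex has level $0$. Repeat the following three phases until none changes any level: Phase 1: while some edge $(m,w)$ labelled $(+1,+1)$ has level$(w)\le$ level$(m)=i$, set level$(w)$=level$(M(w))=i+1$. Phase 2: while some edge $(m,w)$ labelled $(+1,-1)$ or $(-1,+1)$ has level$(w)<$ level$(m)=i$, set level$(w)$=level$(M(w))=i$. Phase 3: while some edge $(m,w)$ labelled $(-1,-1)$ has level$(w)\le$ level$(m)-2$, level$(m)=i$, set level$(w)$=level$(M(w))=i-1$. An SRAP is an alternating path with respect to $M$ in which the number of $(+1,+1)$ edges is one more than the number of $(-1,-1)$ edges, which starts at a woman matched in $M$ at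 level $0$ and ends at a non-critical man (in $A\setminus C$) at level $1$. An SIAP is an alternating path with respect to $M$ with equally many $(+1,+1)$ and $(-1,-1)$ edges whose endpoints are a man and a woman both unmatched in $M$. -}

module Defs where

open import Data.Nat using (ℕ; zero; suc; _+_; _∸_; _≤_; _<_; _<ᵇ_)
open import Data.Fin using (Fin; zero; suc; _≟_)
open import Data.Bool using (Bool; true; false; if_then_else_; _∨_; _∧_; not; _xor_)
open import Data.Maybe using (Maybe; just; nothing)
open import Data.Sum using (_⊎_; inj₁; inj₂)
open import Data.Product using (Σ; _×_; _,_; ∃; ∃-syntax)
open import Data.Unit using (⊤)
open import Data.List using (List; []; _∷_; head; last)
open import Data.List.Relation.Unary.Unique.Propositional using (Unique)
open import Relation.Nullary using (¬_; does)
open import Relation.Binary.PropositionalEquality using (_≡_; _≢_)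
open import Relation.Binary.Construct.Closure.ReflexiveTransitive using (Star)

countT : (n : ℕ) → (Fin n → Bool) → ℕ
countT zero    f = 0
countT (suc n) f = (if f zero then 1 else 0) + countT n (λ i → f (suc i))

-- A marriage instance: men Fin nA, women Fin nB, edges given by adj,
-- strict preference lists given by rank functions injective on neighbours
-- (smaller rank = more preferred).
record Instance : Set where
  field
    nA nB  : ℕ
    adj    : Fin nA → Fin nB → Bool
    rankA  : Fin nA → Fin nB → ℕ
    rankB  : Fin nB → Fin nA → ℕ
    rankA-inj : ∀ m w w' → adj m w ≡ true → adj m w' ≡ true →
                rankA m w ≡ rankA m w' → w ≡ w'
    rankB-inj : ∀ w m m' → adj m w ≡ true → adj m' w ≡ true →
                rankB w m ≡ rankB w m' → m ≡ m'

module _ (I : Instance) where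
  open Instance I

  Vertex : Set
  Vertex = Fin nA ⊎ Fin nB

  record Matching : Set where
    field
      mateA : Fin nA → Maybe (Fin nB)
      mateB : Fin nB → Maybe (Fin nA)
      mate-sym : ∀ m w → mateA m ≡ just w → mateB w ≡ just m
      mate-sym' : ∀ m w → mateB w ≡ just m → mateA m ≡ just w
      mate-adj : ∀ m w → mateA m ≡ just w → adj m w ≡ true
  open Matching public

  -- "m prefers x to y" (being matched beats being unmatched)
  prefA : Fin nA → Maybe (Fin nB) → Maybe (Fin nB) → Bool
  prefA m nothing  _         = false
  prefA m (just w) nothing   = true
  prefA m (just w) (just w') = rankA m w <ᵇ rankA m w'

  prefB : Fin nB → Maybe (Fin nA) → Maybe (Fin nA) → Bool
  prefB w nothing  _         = false
  prefB w (just m) nothing   = true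
  prefB w (just m) (just m') = rankB w m <ᵇ rankB w m'

  φ : Matching → Matching → ℕ
  φ N M = countT nA (λ m → prefA m (mateA N m) (mateA M m))
        + countT nB (λ w → prefB w (mateB N w) (mateB M w))

  -- critical set C ⊆ A given by its characteristic function
  Feasible : (Fin nA → Bool) → Matching → Set
  Feasible C M = ∀ m → C m ≡ true → ∃[ w ] mateA M m ≡ just w

  PopularFeasible : (Fin nA → Bool) → Matching → Set
  PopularFeasible C M = Feasible C M × (∀ N → Feasible C N → φ N M ≤ φ M N)

  module _ (M : Matching) where

    inM : Fin nA → Fin nB → Bool
    inM m w with mateA M m
    ... | nothing = false
    ... | just w' = does (w ≟ w')

    -- labels of an edge (m,w) not in M
    manPlus : Fin nA → Fin nB → Bool
    manPlus m w = prefA m (just w) (mateA M m)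

    womanPlus : Fin nA → Fin nB → Bool
    womanPlus m w = prefB w (just m) (mateB M w)

    NonMEdge : Fin nA → Fin nB → Set
    NonMEdge m w = adj m w ≡ true × inM m w ≡ false

    LabelPP LabelMixed LabelMM : Fin nA → Fin nB → Set
    LabelPP    m w = NonMEdge m w × manPlus m w ≡ true × womanPlus m w ≡ true
    LabelMixed m w = NonMEdge m w × (manPlus m w xor womanPlus m w) ≡ true
    LabelMM    m w = NonMEdge m w × manPlus m w ≡ false × womanPlus m w ≡ false

    Levels : Set
    Levels = Vertex → ℕ

    isPartner : Fin nB → Vertex → Bool
    isPartner w (inj₂ _) = false
    isPartner w (inj₁ m) with mateB M w
    ... | nothing = false
    ... | just m' = does (m ≟ m')

    isW : Fin nB → Vertex → Bool
    isW w (inj₁ _)  = false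
    isW w (inj₂ w') = does (w ≟ w')

    setLev : Levels → Fin nB → ℕ → Levels
    setLev L w k v = if isW w v ∨ isPartner w v then k else L v

    App1 App2 App3 : Levels → Fin nA → Fin nB → Set
    App1 L m w = LabelPP m w    × L (inj₂ w) ≤ L (inj₁ m)
    App2 L m w = LabelMixed m w × L (inj₂ w) < L (inj₁ m)
    App3 L m w = LabelMM m w    × L (inj₂ w) + 2 ≤ L (inj₁ m)

    Step1 Step2 Step3 : Levels → Levels → Set
    Step1 L L' = ∃[ m ] ∃[ w ] App1 L m w × L' ≡ setLev L w (suc (L (inj₁ m)))
    Step2 L L' = ∃[ m ] ∃[ w ] App2 L m w × L' ≡ setLev L w (L (inj₁ m))
    Step3 L L' = ∃[ m ] ∃[ w ] App3 L m w × L' ≡ setLev L w (L (inj₁ m) ∸ 1)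

    -- a phase: repeat its step while applicable (any choice of edges)
    Phase : (Levels → Fin nA → Fin nB → Set) → (Levels → Levels → Set) →
            Levels → Levels → Set
    Phase App Step L L' = Star Step L L' × (∀ m w → ¬ App L' m w)

    Round : Levels → Levels → Set
    Round L L' = ∃[ L₁ ] ∃[ L₂ ] Phase App1 Step1 L L₁ × Phase App2 Step2 L₁ L₂
                                × Phase App3 Step3 L₂ L'

    -- L is a level assignment produced by (some execution of) the
    -- leveling procedure applied to M: rounds starting from all-zero
    -- levels, stopping at a round that changes no level.
    LevelingResult : Levels → Set
    LevelingResult L = Star Round (λ _ → 0) L × Round L L

    data IsEdge : Vertex → Vertex → Set where
      mw : ∀ m w → adj m w ≡ true → IsEdge (inj₁ m) (inj₂ w)
      wm : ∀ m w → adj m w ≡ true → IsEdge (inj₂ w) (inj₁ m)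

    inMV : Vertex → Vertex → Bool
    inMV (inj₁ m) (inj₂ w) = inM m w
    inMV (inj₂ w) (inj₁ m) = inM m w
    inMV _ _ = false

    AltWalk : List Vertex → Set
    AltWalk []           = ⊤
    AltWalk (u ∷ [])     = ⊤
    AltWalk (u ∷ v ∷ []) = IsEdge u v
    AltWalk (u ∷ v ∷ x ∷ vs) = IsEdge u v × inMV u v ≡ not (inMV v x)
                              × AltWalk (v ∷ x ∷ vs)

    AltPath : List Vertex → Set
    AltPath vs = AltWalk vs × Unique vs

    isPPV isMMV : Vertex → Vertex → Bool
    isPPV (inj₁ m) (inj₂ w) = not (inM m w) ∧ manPlus m w ∧ womanPlus m w
    isPPV (inj₂ w) (inj₁ m) = not (inM m w) ∧ manPlus m w ∧ womanPlus m w
    isPPV _ _ = false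
    isMMV (inj₁ m) (inj₂ w) = not (inM m w) ∧ not (manPlus m w) ∧ not (womanPlus m w)
    isMMV (inj₂ w) (inj₁ m) = not (inM m w) ∧ not (manPlus m w) ∧ not (womanPlus m w)
    isMMV _ _ = false

    countEdges : (Vertex → Vertex → Bool) → List Vertex → ℕ
    countEdges p (u ∷ v ∷ vs) = (if p u v then 1 else 0) + countEdges p (v ∷ vs)
    countEdges p _ = 0

    #PP #MM : List Vertex → ℕ
    #PP = countEdges isPPV
    #MM = countEdges isMMV

    IsSIAP : List Vertex → Set
    IsSIAP ps = AltPath ps × #PP ps ≡ #MM ps ×
      (∃[ m ] ∃[ w ] mateA M m ≡ nothing × mateB M w ≡ nothing ×
        ((head ps ≡ just (inj₁ m) × last ps ≡ just (inj₂ w)) ⊎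
         (head ps ≡ just (inj₂ w) × last ps ≡ just (inj₁ m))))

    IsSRAP : (Fin nA → Bool) → Levels → List Vertex → Set
    IsSRAP C L ps = AltPath ps × #PP ps ≡ suc (#MM ps) ×
      (∃[ w ] ∃[ m ] (∃[ m' ] mateB M w ≡ just m') × L (inj₂ w) ≡ 0 ×
        C m ≡ false × L (inj₁ m) ≡ 1 ×
        head ps ≡ just (inj₂ w) × last ps ≡ just (inj₁ m))

-- Orient alternating paths so that matched edges go from a woman to a man. Once the leveling
-- procedure has stopped, every edge (u,v) of such a path satisfies
-- level(u) + [(+1,+1)] ≤ level(v) + [(−1,−1)], and these inequalities add up along paths. Popularity
-- gives the opposite kind of bound: switching M along a path with an exposed end wins no more votes
-- than it loses, which forces #(+1,+1) ≤ #(−1,−1) on it.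
-- Suppose an SIAP p, read from its exposed man, meets an SRAP q. The first vertex of p on q is a
-- woman x₁, and the last vertex of p on q after x₁ is a man y₂ preceded on both paths by his partner
-- x₂. The spliced paths p[..x₁] q[x₁..] and q[..x₂] p[x₂..] can both be switched; adding their two
-- popularity bounds to the level bounds along q[..x₁], p[x₁..x₂] and q[x₂..] gives 2 ≤ 1.

module Submission where

open import Defs
open import Data.Bool using (Bool; true; false; if_then_else_; not; _∧_; _∨_; _xor_; T)
open import Data.Bool.Properties using (∧-identityʳ; ∧-zeroʳ; ¬-not)
open import Data.Empty using (⊥)
open import Data.Fin using (Fin; zero; suc)
open import Data.Fin.Properties using (_≟_)
open import Data.List using (List; []; _∷_; _++_; _∷ʳ_; [_]; head; last; reverse; map; initLast; _∷ʳ′_)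
open import Data.List.Properties using (++-assoc; ∷ʳ-++; unfold-reverse; reverse-++)
open import Data.List.Membership.Propositional using (_∈_; _∉_)
open import Data.List.Membership.Propositional.Properties using (∈-∃++; ∈-++⁺ʳ; ∈-++⁺ˡ)
open import Data.List.Membership.DecPropositional using () renaming (_∈?_ to ∈?)
open import Data.List.Relation.Binary.Permutation.Propositional using (↭-sym; ↭⇒↭ₛ)
open import Data.List.Relation.Binary.Permutation.Propositional.Properties using (↭-reverse)
import Data.List.Relation.Binary.Permutation.Setoid.Properties as PermutationSetoid
open import Data.List.Relation.Unary.All as All using (All; []; _∷_)
open import Data.List.Relation.Unary.All.Properties using (¬Any⇒All¬)
import Data.List.Relation.Unary.All.Properties as Allₚ
open import Data.List.Relation.Unary.AllPairs using ([]; _∷_)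
open import Data.List.Relation.Unary.Any as Any using (Any; here; there; any?)
open import Data.List.Relation.Unary.Any.Properties using (reverse⁺)
open import Data.List.Relation.Unary.Linked as Linked using (Linked; []; [-]; _∷_)
open import Data.List.Relation.Unary.Linked.Properties using (++⁺)
open import Data.List.Relation.Unary.Unique.Propositional using (Unique)
import Data.List.Relation.Unary.Unique.Propositional.Properties as Uniqueₚ
open import Data.Maybe using (Maybe; just; nothing)
open import Data.Maybe.Properties using (just-injective)
open import Data.Maybe.Relation.Binary.Connected using (Connected; just)
open import Data.Nat using (ℕ; zero; suc; _+_; _∸_; _≤_; _<_; _<ᵇ_; z≤n; s≤s)
open import Data.Nat.ListAction using (sum)
open import Data.Nat.Properties
  using (≤-refl; ≤-trans; ≤-reflexive; ≤-antisym; m<1+n⇒m≤n; <⇒≤; ≰⇒>; ≮⇒≥; 1+n≰n; n≤1+n; m≤n⇒m≤1+n;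
         <-cmp; <ᵇ⇒<; <⇒<ᵇ; +-assoc; +-comm; +-suc; +-identityʳ; +-cancelˡ-≤; +-mono-≤; +-monoˡ-≤; +-monoʳ-≤;
         m+n∸n≡m; ∸-monoˡ-≤; +-commutativeSemigroup; module ≤-Reasoning)
open import Algebra.Properties.CommutativeSemigroup +-commutativeSemigroup using (x∙yz≈y∙xz)
open import Data.Nat.Tactic.RingSolver using (solve-∀)
open import Data.Product using (∃; ∃₂; ∃-syntax; _×_; _,_; proj₁; proj₂)
open import Data.Sum using (_⊎_; inj₁; inj₂; swap)
open import Data.Sum.Properties using (≡-dec)
open import Data.Unit using (⊤; tt)
open import Function using (_∘_; flip; id)
open import Level using (Level; _⊔_)
open import Relation.Binary.Core using (Rel)
open import Relation.Binary.Construct.Closure.ReflexiveTransitive using (Star; ε; _◅_)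
open import Relation.Binary.Definitions using (DecidableEquality; tri<; tri≈; tri>)
open import Relation.Binary.PropositionalEquality
  using (_≡_; _≢_; refl; sym; trans; cong; cong₂; subst; subst₂; setoid; module ≡-Reasoning)
open import Relation.Nullary using (¬_; Dec; does; yes; no; contradiction)
open import Relation.Unary using (Pred; Decidable; ∁)

private
  variable
    a p r : Level
    X : Set a

last-∷ʳ : (xs : List X) (x : X) → last (xs ∷ʳ x) ≡ just x
last-∷ʳ []           x = refl
last-∷ʳ (_ ∷ [])     x = refl
last-∷ʳ (_ ∷ y ∷ xs) x = last-∷ʳ (y ∷ xs) x

last-++-∷ : (xs : List X) (y : X) (ys : List X) → last (xs ++ y ∷ ys) ≡ last (y ∷ ys)
last-++-∷ []           y ys = refl
last-++-∷ (_ ∷ [])     y ys = refl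
last-++-∷ (_ ∷ x ∷ xs) y ys = last-++-∷ (x ∷ xs) y ys

head-++-∷ : (xs : List X) (y : X) (ys zs : List X) → head (xs ++ y ∷ ys) ≡ head (xs ++ y ∷ zs)
head-++-∷ []      y ys zs = refl
head-++-∷ (_ ∷ _) y ys zs = refl

head-reverse : (xs : List X) → head (reverse xs) ≡ last xs
head-reverse []           = refl
head-reverse (x ∷ [])     = refl
head-reverse (x ∷ y ∷ xs) = begin
  head (reverse (x ∷ y ∷ xs))      ≡⟨ cong head (unfold-reverse x (y ∷ xs)) ⟩
  head (reverse (y ∷ xs) ∷ʳ x)     ≡⟨ cong (λ zs → head (zs ∷ʳ x)) (unfold-reverse y xs) ⟩
  head ((reverse xs ∷ʳ y) ∷ʳ x)    ≡⟨ cong head (++-assoc (reverse xs) [ y ] [ x ]) ⟩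
  head (reverse xs ++ y ∷ x ∷ [])  ≡⟨ head-++-∷ (reverse xs) y [ x ] [] ⟩
  head (reverse xs ∷ʳ y)           ≡⟨ cong head (unfold-reverse y xs) ⟨
  head (reverse (y ∷ xs))          ≡⟨ head-reverse (y ∷ xs) ⟩
  last (y ∷ xs)                    ∎
  where open ≡-Reasoning

last-reverse : (xs : List X) → last (reverse xs) ≡ head xs
last-reverse []       = refl
last-reverse (x ∷ xs) = trans (cong last (unfold-reverse x xs)) (last-∷ʳ (reverse xs) x)

reverse-++-∷ : (xs : List X) (y : X) (ys : List X) → reverse (xs ++ y ∷ ys) ≡ reverse ys ++ y ∷ reverse xs
reverse-++-∷ xs y ys = begin
  reverse (xs ++ y ∷ ys)           ≡⟨ reverse-++ xs (y ∷ ys) ⟩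
  reverse (y ∷ ys) ++ reverse xs   ≡⟨ cong (_++ reverse xs) (unfold-reverse y ys) ⟩
  (reverse ys ∷ʳ y) ++ reverse xs  ≡⟨ ++-assoc (reverse ys) [ y ] (reverse xs) ⟩
  reverse ys ++ y ∷ reverse xs     ∎
  where open ≡-Reasoning

module _ {R : Rel X r} where

  Linked-split : ∀ xs {y : X} ys → Linked R (xs ++ y ∷ ys) → Linked R (xs ∷ʳ y) × Linked R (y ∷ ys)
  Linked-split []           ys l         = [-] , l
  Linked-split (_ ∷ [])     ys (r ∷ l)   = r ∷ [-] , l
  Linked-split (_ ∷ x ∷ xs) ys (r ∷ l) with Linked-split (x ∷ xs) ys l
  ... | l₁ , l₂ = r ∷ l₁ , l₂

  Linked-join : ∀ xs {y : X} ys → Linked R (xs ∷ʳ y) → Linked R (y ∷ ys) → Linked R (xs ++ y ∷ ys)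
  Linked-join []           ys _         l = l
  Linked-join (_ ∷ [])     ys (r ∷ _)   l = r ∷ l
  Linked-join (_ ∷ x ∷ xs) ys (r ∷ l₁)  l = r ∷ Linked-join (x ∷ xs) ys l₁ l

  Linked-reverse : ∀ {xs : List X} → Linked R xs → Linked (flip R) (reverse xs)
  Linked-reverse []                  = []
  Linked-reverse [-]                 = [-]
  Linked-reverse {x ∷ y ∷ xs} (r ∷ l) =
    subst (Linked (flip R)) (sym (unfold-reverse x (y ∷ xs)))
      (++⁺ (Linked-reverse l) (subst (λ m → Connected (flip R) m (just x)) (sym (last-reverse (y ∷ xs))) (just r)) [-])

Unique-++⁻ : ∀ (xs : List X) {ys} → Unique (xs ++ ys) → Unique xs × Unique ys
Unique-++⁻ []       u        = [] , u
Unique-++⁻ (x ∷ xs) (x∉ ∷ u) with Unique-++⁻ xs u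
... | u₁ , u₂ = Allₚ.++⁻ˡ xs x∉ ∷ u₁ , u₂

Unique-reverse : {xs : List X} → Unique xs → Unique (reverse xs)
Unique-reverse {X = X} {xs} = PermutationSetoid.Unique-resp-↭ (setoid X) (↭⇒↭ₛ (↭-sym (↭-reverse xs)))

module _ {P : Pred X p} (P? : Decidable P) where

  first-split : ∀ {xs} → Any P xs → ∃₂ λ pre post → ∃ λ z → xs ≡ pre ++ z ∷ post × P z × All (∁ P) pre
  first-split {x ∷ xs} hit with P? x | hit
  ... | yes px | _          = [] , xs , x , refl , px , []
  ... | no ¬px | here px    = contradiction px ¬px
  ... | no ¬px | there hit′ with first-split hit′
  ...   | pre , post , z , refl , pz , miss = x ∷ pre , post , z , refl , pz , ¬px ∷ miss

  last-split : ∀ {xs} → Any P xs → ∃₂ λ pre post → ∃ λ z → xs ≡ pre ++ z ∷ post × P z × All (∁ P) post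
  last-split {x ∷ xs} hit with any? P? xs | hit
  ... | yes hit′ | _ with last-split hit′
  ...   | pre , post , z , refl , pz , miss = x ∷ pre , post , z , refl , pz , miss
  last-split {x ∷ xs} hit | no ¬hit | here px   = [] , xs , x , refl , px , ¬Any⇒All¬ xs ¬hit
  last-split {x ∷ xs} hit | no ¬hit | there hit′ = contradiction hit′ ¬hit

record Walk {X : Set a} (R : Rel X r) (u v : X) (xs : List X) : Set (a ⊔ r) where
  field
    linked : Linked R xs
    starts : head xs ≡ just u
    ends   : last xs ≡ just v

module _ {R : Rel X r} {u v : X} where

  Walk-split : ∀ xs {z} ys → Walk R u v (xs ++ z ∷ ys) → Walk R u z (xs ∷ʳ z) × Walk R z v (z ∷ ys)
  Walk-split xs {z} ys w = record { linked = l₁ ; starts = trans (head-++-∷ xs z [] ys) starts ; ends = last-∷ʳ xs z }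
                         , record { linked = l₂ ; starts = refl ; ends = trans (sym (last-++-∷ xs z ys)) ends }
    where
      open Walk w
      l₁ = proj₁ (Linked-split xs ys linked)
      l₂ = proj₂ (Linked-split xs ys linked)

  Walk-join : ∀ xs {z} ys → Walk R u z (xs ∷ʳ z) → Walk R z v (z ∷ ys) → Walk R u v (xs ++ z ∷ ys)
  Walk-join xs {z} ys w₁ w₂ = record
    { linked = Linked-join xs ys (Walk.linked w₁) (Walk.linked w₂)
    ; starts = trans (head-++-∷ xs z ys []) (Walk.starts w₁)
    ; ends   = trans (last-++-∷ xs z ys) (Walk.ends w₂)
    }

  Walk-reverse : ∀ {xs} → Walk R u v xs → Walk (flip R) v u (reverse xs)
  Walk-reverse {xs} w = record
    { linked = Linked-reverse (Walk.linked w)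
    ; starts = trans (head-reverse xs) (Walk.ends w)
    ; ends   = trans (last-reverse xs) (Walk.starts w)
    }

module _ (_≟_ : DecidableEquality X) where

  next : List X → X → Maybe X
  next []       v = nothing
  next (x ∷ xs) v with v ≟ x
  ... | yes _ = head xs
  ... | no  _ = next xs v

  prev : List X → X → Maybe X
  prev xs = next (reverse xs)

  next-at : ∀ pre {x} post → Unique (pre ++ x ∷ post) → next (pre ++ x ∷ post) x ≡ head post
  next-at []        {x} post _ with x ≟ x
  ... | yes _  = refl
  ... | no x≢x = contradiction refl x≢x
  next-at (y ∷ pre) {x} post (y∉ ∷ u) with x ≟ y
  ... | yes refl = contradiction refl (All.lookup y∉ (∈-++⁺ʳ pre (here refl)))
  ... | no  _    = next-at pre post u

  prev-at : ∀ pre {x} post → Unique (pre ++ x ∷ post) → prev (pre ++ x ∷ post) x ≡ last pre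
  prev-at pre {x} post u = begin
    next (reverse (pre ++ x ∷ post)) x         ≡⟨ cong (λ xs → next xs x) (reverse-++-∷ pre x post) ⟩
    next (reverse post ++ x ∷ reverse pre) x   ≡⟨ next-at (reverse post) (reverse pre) u′ ⟩
    head (reverse pre)                         ≡⟨ head-reverse pre ⟩
    last pre                                   ∎
    where
      open ≡-Reasoning
      u′ = subst Unique (reverse-++-∷ pre x post) (Unique-reverse u)

sumEdges : (X → X → ℕ) → List X → ℕ
sumEdges f (u ∷ v ∷ vs) = f u v + sumEdges f (v ∷ vs)
sumEdges f _            = 0

sum-by-neighbours : (g : X → ℕ) (before : Maybe X → X → ℕ) (after : X → Maybe X → ℕ) →
  ∀ {s t} xs → head xs ≡ just s → last xs ≡ just t →
  (∀ pre v post → xs ≡ pre ++ v ∷ post → g v ≡ before (last pre) v + after v (head post)) →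
  sum (map g xs) ≡ before nothing s + sumEdges (λ u v → after u (just v) + before (just u) v) xs + after t nothing
sum-by-neighbours g before after {t = t} (x ∷ xs) refl lst split = go [] x xs refl lst
  where
    edge = λ u v → after u (just v) + before (just u) v
    go : ∀ pre y ys → x ∷ xs ≡ pre ++ y ∷ ys → last (y ∷ ys) ≡ just t →
         sum (map g (y ∷ ys)) ≡ before (last pre) y + sumEdges edge (y ∷ ys) + after t nothing
    go pre y [] e refl = begin
      g y + 0                                 ≡⟨ +-identityʳ (g y) ⟩
      g y                                     ≡⟨ split pre y [] e ⟩
      before (last pre) y + after y nothing   ≡⟨ cong (_+ after y nothing) (+-identityʳ _) ⟨
      before (last pre) y + 0 + after y nothing ∎
      where open ≡-Reasoning
    go pre y (z ∷ zs) e lst′ = begin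
      g y + sum (map g (z ∷ zs))
        ≡⟨ cong₂ _+_ (split pre y (z ∷ zs) e) (go (pre ∷ʳ y) z zs e′ lst′) ⟩
      (into-y + after y (just z)) + (before (last (pre ∷ʳ y)) z + edges + end)
        ≡⟨ cong (λ l → into-y + after y (just z) + (before l z + edges + end)) (last-∷ʳ pre y) ⟩
      (into-y + after y (just z)) + (before (just y) z + edges + end)
        ≡⟨ regroup into-y (after y (just z)) (before (just y) z) edges end ⟩
      into-y + (edge y z + edges) + end ∎
      where
        open ≡-Reasoning
        into-y = before (last pre) y
        edges = sumEdges edge (z ∷ zs)
        end = after t nothing
        e′ = trans e (sym (++-assoc pre [ y ] (z ∷ zs)))
        regroup : ∀ a b c d e → (a + b) + (c + d + e) ≡ a + (b + c + d) + e
        regroup = solve-∀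

Linked-at : ∀ {R : Rel X r} pre {u v} post → Linked R (pre ++ u ∷ v ∷ post) → R u v
Linked-at pre post l = Linked.head (proj₂ (Linked-split pre (_ ∷ post) l))

sumEdges-split : ∀ (f : X → X → ℕ) xs {z} ys → sumEdges f (xs ++ z ∷ ys) ≡ sumEdges f (xs ∷ʳ z) + sumEdges f (z ∷ ys)
sumEdges-split f []           ys = refl
sumEdges-split f (x ∷ [])     ys = cong (_+ sumEdges f (_ ∷ ys)) (sym (+-identityʳ _))
sumEdges-split f (x ∷ y ∷ xs) ys = trans (cong (f x y +_) (sumEdges-split f (y ∷ xs) ys)) (sym (+-assoc (f x y) _ _))

sumEdges-reverse : ∀ (f : X → X → ℕ) → (∀ u v → f u v ≡ f v u) → ∀ xs → sumEdges f (reverse xs) ≡ sumEdges f xs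
sumEdges-reverse f sym-f []           = refl
sumEdges-reverse f sym-f (x ∷ [])     = refl
sumEdges-reverse f sym-f (x ∷ y ∷ xs) = begin
  sumEdges f (reverse (x ∷ y ∷ xs))                    ≡⟨ cong (sumEdges f) (reverse-++-∷ [ x ] y xs) ⟩
  sumEdges f (reverse xs ++ y ∷ x ∷ [])                ≡⟨ sumEdges-split f (reverse xs) [ x ] ⟩
  sumEdges f (reverse xs ∷ʳ y) + (f y x + 0)
    ≡⟨ cong₂ _+_ (cong (sumEdges f) (unfold-reverse y xs)) (sym (+-identityʳ (f y x))) ⟨
  sumEdges f (reverse (y ∷ xs)) + f y x                ≡⟨ cong₂ _+_ (sumEdges-reverse f sym-f (y ∷ xs)) (sym-f y x) ⟩
  sumEdges f (y ∷ xs) + f x y                          ≡⟨ +-comm _ (f x y) ⟩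
  sumEdges f (x ∷ y ∷ xs)                              ∎
  where open ≡-Reasoning

Linked-direction : ∀ {R : Rel X r} {s t xs} → s ≢ t → head xs ≡ just s → last xs ≡ just t →
  (∀ {y} → ¬ R y s) → Linked R xs ⊎ Linked (flip R) xs → Linked R xs
Linked-direction s≢t _    _    _       (inj₁ l)       = l
Linked-direction s≢t refl refl _       (inj₂ [-])     = contradiction refl s≢t
Linked-direction s≢t refl _    no-pred (inj₂ (r ∷ _)) = contradiction r no-pred

𝟙 : Bool → ℕ
𝟙 b = if b then 1 else 0

countT-cong : ∀ n {f g : Fin n → Bool} → (∀ i → f i ≡ g i) → countT n f ≡ countT n g
countT-cong zero    f≡g = refl
countT-cong (suc n) f≡g = cong₂ _+_ (cong 𝟙 (f≡g zero)) (countT-cong n (f≡g ∘ suc))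

countT-none : ∀ n {f : Fin n → Bool} → (∀ i → f i ≡ false) → countT n f ≡ 0
countT-none zero    f≡false = refl
countT-none (suc n) f≡false = cong₂ _+_ (cong 𝟙 (f≡false zero)) (countT-none n (f≡false ∘ suc))

countT-remove : ∀ n (f : Fin n → Bool) k →
  countT n f ≡ 𝟙 (f k) + countT n (λ i → f i ∧ not (does (i ≟ k)))
countT-remove (suc n) f zero =
  cong (𝟙 (f zero) +_) (sym (cong₂ _+_ (cong 𝟙 (∧-zeroʳ (f zero))) (countT-cong n (λ i → ∧-identityʳ (f (suc i))))))
countT-remove (suc n) f (suc k) = begin
  𝟙 (f zero) + countT n (f ∘ suc)
    ≡⟨ cong (𝟙 (f zero) +_) (countT-remove n (f ∘ suc) k) ⟩
  𝟙 (f zero) + (𝟙 (f (suc k)) + countT n (λ i → f (suc i) ∧ not (does (i ≟ k))))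
    ≡⟨ x∙yz≈y∙xz (𝟙 (f zero)) (𝟙 (f (suc k))) _ ⟩
  𝟙 (f (suc k)) + (𝟙 (f zero) + countT n (λ i → f (suc i) ∧ not (does (i ≟ k))))
    ≡⟨ cong (λ b → 𝟙 (f (suc k)) + (𝟙 b + countT n (λ i → f (suc i) ∧ not (does (i ≟ k)))))
            (∧-identityʳ (f zero)) ⟨
  𝟙 (f (suc k)) + (𝟙 (f zero ∧ true) + countT n (λ i → f (suc i) ∧ not (does (i ≟ k))))
    ∎
  where open ≡-Reasoning

module _ {nA nB : ℕ} where

  _≟ᵥ_ : DecidableEquality (Fin nA ⊎ Fin nB)
  _≟ᵥ_ = ≡-dec _≟_ _≟_

  countV : (Fin nA ⊎ Fin nB → Bool) → ℕ
  countV g = countT nA (g ∘ inj₁) + countT nB (g ∘ inj₂)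

  countV-remove : ∀ g x → countV g ≡ 𝟙 (g x) + countV (λ v → g v ∧ not (does (v ≟ᵥ x)))
  countV-remove g (inj₁ k) = begin
    countT nA (g ∘ inj₁) + countT nB (g ∘ inj₂)
      ≡⟨ cong₂ _+_ (countT-remove nA (g ∘ inj₁) k) (countT-cong nB (λ w → sym (∧-identityʳ (g (inj₂ w))))) ⟩
    (𝟙 (g (inj₁ k)) + _) + _
      ≡⟨ +-assoc (𝟙 (g (inj₁ k))) _ _ ⟩
    𝟙 (g (inj₁ k)) + countV (λ v → g v ∧ not (does (v ≟ᵥ inj₁ k))) ∎
    where open ≡-Reasoning
  countV-remove g (inj₂ k) = begin
    countT nA (g ∘ inj₁) + countT nB (g ∘ inj₂)
      ≡⟨ cong₂ _+_ (countT-cong nA (λ m → sym (∧-identityʳ (g (inj₁ m))))) (countT-remove nB (g ∘ inj₂) k) ⟩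
    restA + (𝟙 (g (inj₂ k)) + restB)
      ≡⟨ x∙yz≈y∙xz restA (𝟙 (g (inj₂ k))) restB ⟩
    𝟙 (g (inj₂ k)) + countV (λ v → g v ∧ not (does (v ≟ᵥ inj₂ k))) ∎
    where
      open ≡-Reasoning
      restA = countT nA (λ m → g (inj₁ m) ∧ true)
      restB = countT nB (λ w → g (inj₂ w) ∧ not (does (w ≟ k)))

  countV-sum : ∀ g {xs} → Unique xs → (∀ v → v ∉ xs → g v ≡ false) → countV g ≡ sum (map (𝟙 ∘ g) xs)
  countV-sum g {[]} _ vanishes =
    cong₂ _+_ (countT-none nA (λ m → vanishes (inj₁ m) λ ())) (countT-none nB (λ w → vanishes (inj₂ w) λ ()))
  countV-sum g {x ∷ xs} (x∉ ∷ u) vanishes = begin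
    countV g                    ≡⟨ countV-remove g x ⟩
    𝟙 (g x) + countV g′          ≡⟨ cong (𝟙 (g x) +_) (countV-sum g′ u vanishes′) ⟩
    𝟙 (g x) + sum (map (𝟙 ∘ g′) xs) ≡⟨ cong (𝟙 (g x) +_) (sum-map-cong x∉) ⟩
    𝟙 (g x) + sum (map (𝟙 ∘ g) xs) ∎
    where
      open ≡-Reasoning
      g′ = λ v → g v ∧ not (does (v ≟ᵥ x))
      vanishes′ : ∀ v → v ∉ xs → g′ v ≡ false
      vanishes′ v v∉ with v ≟ᵥ x
      ... | yes refl = ∧-zeroʳ (g v)
      ... | no  v≢x  = trans (∧-identityʳ (g v)) (vanishes v λ { (here v≡x) → v≢x v≡x ; (there v∈) → v∉ v∈ })
      sum-map-cong : ∀ {ys} → All (x ≢_) ys → sum (map (𝟙 ∘ g′) ys) ≡ sum (map (𝟙 ∘ g) ys)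
      sum-map-cong []               = refl
      sum-map-cong {y ∷ _} (x≢y ∷ x∉) with y ≟ᵥ x
      ... | yes refl = contradiction refl x≢y
      ... | no  _    = cong₂ _+_ (cong 𝟙 (∧-identityʳ (g y))) (sum-map-cong x∉)

𝟙≤1 : ∀ b → 𝟙 b ≤ 1
𝟙≤1 true  = ≤-refl
𝟙≤1 false = z≤n

twice-≤-suc : ∀ {p q} → p + p ≤ suc (q + q) → p ≤ q
twice-≤-suc {zero}  _ = z≤n
twice-≤-suc {suc p} {zero} h rewrite +-suc p p with h
... | s≤s ()
twice-≤-suc {suc p} {suc q} h rewrite +-suc p p | +-suc q q with h
... | s≤s (s≤s h′) = s≤s (twice-≤-suc h′)

offset-≤-trans : ∀ a b c {p q p′ q′} → a + p ≤ b + q → b + p′ ≤ c + q′ → a + (p + p′) ≤ c + (q + q′)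
offset-≤-trans a b c {p} {q} {p′} {q′} h₁ h₂ = +-cancelˡ-≤ b _ _ (begin
  b + (a + (p + p′))   ≡⟨ shuffle a b p p′ ⟩
  (a + p) + (b + p′)   ≤⟨ +-mono-≤ h₁ h₂ ⟩
  (b + q) + (c + q′)   ≡⟨ regroup b c q q′ ⟩
  b + (c + (q + q′))   ∎)
  where
    open ≤-Reasoning
    shuffle : ∀ a b p p′ → b + (a + (p + p′)) ≡ (a + p) + (b + p′)
    shuffle = solve-∀
    regroup : ∀ b c q q′ → (b + q) + (c + q′) ≡ b + (c + (q + q′))
    regroup = solve-∀

<ᵇ-connex : ∀ {a b} → a ≢ b → (a <ᵇ b) ≡ not (b <ᵇ a)
<ᵇ-connex {a} {b} a≢b with <-cmp a b
... | tri< a<b _ b≮a = ¬-not λ e → b≮a (<ᵇ⇒< b a (subst T e (<⇒<ᵇ a<b)))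
... | tri≈ _ a≡b _   = contradiction a≡b a≢b
... | tri> a≮b _ b<a = ¬-not λ e → a≮b (<ᵇ⇒< a b (subst T (sym e) (<⇒<ᵇ b<a)))

<ᵇ-irrefl : ∀ n → (n <ᵇ n) ≡ false
<ᵇ-irrefl zero    = refl
<ᵇ-irrefl (suc n) = <ᵇ-irrefl n

-- Alternating walks

module Oriented (I : Instance) (M : Matching I) where
  open Instance I

  -- Read in the right direction, an alternating path is a walk along _↝_.
  _↝_ : Vertex I → Vertex I → Set
  inj₁ m ↝ inj₂ w = NonMEdge I M m w
  inj₂ w ↝ inj₁ m = mateA M m ≡ just w
  inj₁ _ ↝ inj₁ _ = ⊥
  inj₂ _ ↝ inj₂ _ = ⊥

  inM-just : ∀ {m w} → mateA M m ≡ just w → inM I M m w ≡ true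
  inM-just {m} {w} eq with mateA M m
  inM-just {m} {w} refl | just .w with w ≟ w
  ... | yes _  = refl
  ... | no w≢w = contradiction refl w≢w

  inM-true : ∀ {m w} → inM I M m w ≡ true → mateA M m ≡ just w
  inM-true {m} {w} eq with mateA M m
  inM-true {m} {w} () | nothing
  ... | just w′ with w ≟ w′
  ... | yes refl = refl
  inM-true {m} {w} () | just w′ | no _

  partner-unique : ∀ {m m′ w} → mateA M m ≡ just w → mateA M m′ ≡ just w → m ≡ m′
  partner-unique e e′ = just-injective (trans (sym (mate-sym M _ _ e)) (mate-sym M _ _ e′))

  edge-oriented : ∀ {u v} → IsEdge I M u v → u ↝ v ⊎ v ↝ u
  edge-oriented (mw m w adjacent) with inM I M m w in e
  ... | false = inj₁ (adjacent , refl)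
  ... | true  = inj₂ (inM-true e)
  edge-oriented (wm m w adjacent) with inM I M m w in e
  ... | false = inj₂ (adjacent , refl)
  ... | true  = inj₁ (inM-true e)

  oriented-before : ∀ {u v x} → IsEdge I M u v → inMV I M u v ≡ not (inMV I M v x) → v ↝ x → u ↝ v
  oriented-before {x = inj₂ w} (wm m w′ _)        alt (_ , m≁w) rewrite m≁w = inM-true alt
  oriented-before {x = inj₁ m} (mw m′ w adjacent) alt w↝m rewrite inM-just w↝m = adjacent , alt

  oriented-after : ∀ {u v x} → IsEdge I M u v → inMV I M u v ≡ not (inMV I M v x) → x ↝ v → v ↝ u
  oriented-after {x = inj₁ m} (mw m′ w _)        alt (_ , m≁w) rewrite m≁w = inM-true alt
  oriented-after {x = inj₂ w} (wm m w′ adjacent) alt w↝m rewrite inM-just w↝m = adjacent , alt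

  alternating⇒oriented : ∀ {xs} → AltWalk I M xs → Linked _↝_ xs ⊎ Linked (flip _↝_) xs
  alternating⇒oriented {[]}            _ = inj₁ []
  alternating⇒oriented {_ ∷ []}        _ = inj₁ [-]
  alternating⇒oriented {_ ∷ _ ∷ []}    e with edge-oriented e
  ... | inj₁ u↝v = inj₁ (u↝v ∷ [-])
  ... | inj₂ v↝u = inj₂ (v↝u ∷ [-])
  alternating⇒oriented {_ ∷ _ ∷ _ ∷ _} (e , alt , rest) with alternating⇒oriented rest
  ... | inj₁ l@(v↝x ∷ _) = inj₁ (oriented-before e alt v↝x ∷ l)
  ... | inj₂ l@(x↝v ∷ _) = inj₂ (oriented-after e alt x↝v ∷ l)

  MatchedPairIn : List (Vertex I) → Fin nB → Fin nA → Set
  MatchedPairIn ℓ w m = mateA M m ≡ just w × ∃₂ λ pre post → ℓ ≡ pre ++ inj₂ w ∷ inj₁ m ∷ post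

  MatchedPairIn⇒woman∈ : ∀ {ℓ w m} → MatchedPairIn ℓ w m → inj₂ w ∈ ℓ
  MatchedPairIn⇒woman∈ (_ , pre , _ , refl) = ∈-++⁺ʳ pre (here refl)

  MatchedPairIn⇒man∈ : ∀ {ℓ w m} → MatchedPairIn ℓ w m → inj₁ m ∈ ℓ
  MatchedPairIn⇒man∈ (_ , pre , _ , refl) = ∈-++⁺ʳ pre (there (here refl))

  module _ {s t : Vertex I} {ℓ : List (Vertex I)} (walk : Walk _↝_ s t ℓ) where
    open Walk walk

    woman-successor : ∀ pre {w} post → ℓ ≡ pre ++ inj₂ w ∷ post → inj₂ w ≢ t →
                      ∃[ m ] mateA M m ≡ just w × ∃[ post′ ] post ≡ inj₁ m ∷ post′
    woman-successor pre []             refl w≢t = contradiction (just-injective (trans (sym (last-++-∷ pre _ [])) ends)) w≢t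
    woman-successor pre (inj₁ m ∷ post) refl _  = m , Linked-at pre post linked , post , refl
    woman-successor pre (inj₂ _ ∷ post) refl _ with () ← Linked-at pre post linked

    man-predecessor : ∀ pre {m} post → ℓ ≡ pre ++ inj₁ m ∷ post → inj₁ m ≢ s →
                      ∃[ w ] mateA M m ≡ just w × ∃[ pre′ ] pre ≡ pre′ ∷ʳ inj₂ w
    man-predecessor pre post refl m≢s with initLast pre
    ... | [] = contradiction (just-injective starts) m≢s
    ... | pre′ ∷ʳ′ inj₂ w = w , Linked-at pre′ post (subst (Linked _↝_) (∷ʳ-++ pre′ _ _) linked) , pre′ , refl
    ... | pre′ ∷ʳ′ inj₁ _ with () ← Linked-at pre′ post (subst (Linked _↝_) (∷ʳ-++ pre′ _ _) linked)

    woman-matched-on-walk : ∀ {w} → inj₂ w ∈ ℓ → inj₂ w ≢ t → ∃[ m ] MatchedPairIn ℓ w m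
    woman-matched-on-walk w∈ w≢t with ∈-∃++ w∈
    ... | pre , post , eq with woman-successor pre post eq w≢t
    ...   | m , mate , post′ , refl = m , mate , pre , post′ , eq

    man-matched-on-walk : ∀ {m} → inj₁ m ∈ ℓ → inj₁ m ≢ s → ∃[ w ] MatchedPairIn ℓ w m
    man-matched-on-walk m∈ m≢s with ∈-∃++ m∈
    ... | pre , post , eq with man-predecessor pre post eq m≢s
    ...   | w , mate , pre′ , refl = w , mate , pre′ , post , trans eq (∷ʳ-++ pre′ _ _)

  exposed-man-no-predecessor : ∀ {m} → mateA M m ≡ nothing → ∀ {u} → ¬ (u ↝ inj₁ m)
  exposed-man-no-predecessor exposed {inj₂ w} w↝m = contradiction (trans (sym exposed) w↝m) λ ()

  exposed-woman-no-successor : ∀ {w} → mateB M w ≡ nothing → ∀ {v} → ¬ (inj₂ w ↝ v)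
  exposed-woman-no-successor {w} exposed {inj₁ m} w↝m = contradiction (trans (sym exposed) (mate-sym M m w w↝m)) λ ()

  countEdges-sumEdges : ∀ p xs → countEdges I M p xs ≡ sumEdges (λ u v → 𝟙 (p u v)) xs
  countEdges-sumEdges p (u ∷ v ∷ xs) = cong (𝟙 (p u v) +_) (countEdges-sumEdges p (v ∷ xs))
  countEdges-sumEdges p []           = refl
  countEdges-sumEdges p (_ ∷ [])     = refl

  countEdges-split : ∀ p xs {z} ys →
    countEdges I M p (xs ++ z ∷ ys) ≡ countEdges I M p (xs ∷ʳ z) + countEdges I M p (z ∷ ys)
  countEdges-split p xs {z} ys = begin
    countEdges I M p (xs ++ z ∷ ys)                        ≡⟨ countEdges-sumEdges p (xs ++ z ∷ ys) ⟩
    sumEdges f (xs ++ z ∷ ys)                              ≡⟨ sumEdges-split f xs ys ⟩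
    sumEdges f (xs ∷ʳ z) + sumEdges f (z ∷ ys)
      ≡⟨ cong₂ _+_ (countEdges-sumEdges p (xs ∷ʳ z)) (countEdges-sumEdges p (z ∷ ys)) ⟨
    countEdges I M p (xs ∷ʳ z) + countEdges I M p (z ∷ ys) ∎
    where
      open ≡-Reasoning
      f = λ u v → 𝟙 (p u v)

  countEdges-reverse : ∀ p → (∀ u v → p u v ≡ p v u) → ∀ xs → countEdges I M p (reverse xs) ≡ countEdges I M p xs
  countEdges-reverse p p-sym xs = begin
    countEdges I M p (reverse xs)   ≡⟨ countEdges-sumEdges p (reverse xs) ⟩
    sumEdges f (reverse xs)         ≡⟨ sumEdges-reverse f (λ u v → cong 𝟙 (p-sym u v)) xs ⟩
    sumEdges f xs                   ≡⟨ countEdges-sumEdges p xs ⟨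
    countEdges I M p xs             ∎
    where
      open ≡-Reasoning
      f = λ u v → 𝟙 (p u v)

  isPPV-sym : ∀ u v → isPPV I M u v ≡ isPPV I M v u
  isPPV-sym (inj₁ _) (inj₁ _) = refl
  isPPV-sym (inj₁ _) (inj₂ _) = refl
  isPPV-sym (inj₂ _) (inj₁ _) = refl
  isPPV-sym (inj₂ _) (inj₂ _) = refl

  isMMV-sym : ∀ u v → isMMV I M u v ≡ isMMV I M v u
  isMMV-sym (inj₁ _) (inj₁ _) = refl
  isMMV-sym (inj₁ _) (inj₂ _) = refl
  isMMV-sym (inj₂ _) (inj₁ _) = refl
  isMMV-sym (inj₂ _) (inj₂ _) = refl

  -- Switching M along a walk

  prefA-irrefl : ∀ m x → prefA I m x x ≡ false
  prefA-irrefl m nothing  = refl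
  prefA-irrefl m (just w) = <ᵇ-irrefl (rankA m w)

  prefB-irrefl : ∀ w x → prefB I w x x ≡ false
  prefB-irrefl w nothing  = refl
  prefB-irrefl w (just m) = <ᵇ-irrefl (rankB w m)

  manPlus-flip : ∀ {m w} → NonMEdge I M m w → prefA I m (mateA M m) (just w) ≡ not (manPlus I M m w)
  manPlus-flip {m} {w} (adjacent , m≁w) = flip-at (mateA M m) refl
    where
      flip-at : ∀ x → mateA M m ≡ x → prefA I m x (just w) ≡ not (prefA I m (just w) x)
      flip-at nothing   _  = refl
      flip-at (just w′) eq = <ᵇ-connex λ same-rank →
        let w′≡w = rankA-inj m w′ w (mate-adj M m w′ eq) adjacent same-rank
        in contradiction (trans (sym (inM-just (subst (λ x → mateA M m ≡ just x) w′≡w eq))) m≁w) λ ()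

  womanPlus-flip : ∀ {m w} → NonMEdge I M m w → prefB I w (mateB M w) (just m) ≡ not (womanPlus I M m w)
  womanPlus-flip {m} {w} (adjacent , m≁w) = flip-at (mateB M w) refl
    where
      flip-at : ∀ x → mateB M w ≡ x → prefB I w x (just m) ≡ not (prefB I w (just m) x)
      flip-at nothing   _  = refl
      flip-at (just m′) eq = <ᵇ-connex λ same-rank →
        let m′≡m = rankB-inj w m′ m (mate-adj M m′ w (mate-sym' M m′ w eq)) adjacent same-rank
        in contradiction (trans (sym (inM-just (mate-sym' M m w (subst (λ x → mateB M w ≡ just x) m′≡m eq)))) m≁w) λ ()

  asWoman : Maybe (Vertex I) → Maybe (Fin nB)
  asWoman (just (inj₂ w)) = just w
  asWoman _               = nothing

  asMan : Maybe (Vertex I) → Maybe (Fin nA)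
  asMan (just (inj₁ m)) = just m
  asMan _               = nothing

  asWoman-just : ∀ {x w} → asWoman x ≡ just w → x ≡ just (inj₂ w)
  asWoman-just {just (inj₂ _)} refl = refl

  last-asMan : ∀ pre {m} → asMan (last pre) ≡ just m → ∃[ pre′ ] pre ≡ pre′ ∷ʳ inj₁ m
  last-asMan pre e with initLast pre
  ... | pre′ ∷ʳ′ inj₁ _ with refl ← trans (sym (cong asMan (last-∷ʳ pre′ _))) e = pre′ , refl
  last-asMan pre e | pre′ ∷ʳ′ inj₂ _ with () ← trans (sym (cong asMan (last-∷ʳ pre′ _))) e

  -- A man's vote between M and M ⊕ ℓ depends only on his successor on ℓ, a woman's only on her predecessor.
  gainBefore lossBefore : Maybe (Vertex I) → Vertex I → ℕ
  gainBefore p (inj₂ w) = 𝟙 (prefB I w (asMan p) (mateB M w))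
  gainBefore p (inj₁ _) = 0
  lossBefore p (inj₂ w) = 𝟙 (prefB I w (mateB M w) (asMan p))
  lossBefore p (inj₁ _) = 0

  gainAfter lossAfter : Vertex I → Maybe (Vertex I) → ℕ
  gainAfter (inj₁ m) n = 𝟙 (prefA I m (asWoman n) (mateA M m))
  gainAfter (inj₂ _) n = 0
  lossAfter (inj₁ m) n = 𝟙 (prefA I m (mateA M m) (asWoman n))
  lossAfter (inj₂ _) n = 0

  gainEdge lossEdge : Vertex I → Vertex I → ℕ
  gainEdge u v = gainAfter u (just v) + gainBefore (just u) v
  lossEdge u v = lossAfter u (just v) + lossBefore (just u) v

  edge-vote-balance : ∀ {u v} → u ↝ v →
    gainEdge u v + (𝟙 (isMMV I M u v) + 𝟙 (isMMV I M u v)) ≡ lossEdge u v + (𝟙 (isPPV I M u v) + 𝟙 (isPPV I M u v))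
  edge-vote-balance {inj₁ m} {inj₂ w} m↝w@(_ , m≁w)
    rewrite manPlus-flip m↝w | womanPlus-flip m↝w | m≁w with manPlus I M m w | womanPlus I M m w
  ... | true  | true  = refl
  ... | true  | false = refl
  ... | false | true  = refl
  ... | false | false = refl
  edge-vote-balance {inj₂ w} {inj₁ m} w↝m rewrite inM-just w↝m = refl

  vote-balance : ∀ {xs} → Linked _↝_ xs →
    sumEdges gainEdge xs + (#MM I M xs + #MM I M xs) ≡ sumEdges lossEdge xs + (#PP I M xs + #PP I M xs)
  vote-balance []        = refl
  vote-balance [-]       = refl
  vote-balance {u ∷ v ∷ xs} (u↝v ∷ l) = begin
    (gainEdge u v + sumEdges gainEdge (v ∷ xs)) + ((c + c′) + (c + c′))
      ≡⟨ shuffle (gainEdge u v) _ c c′ ⟩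
    (gainEdge u v + (c + c)) + (sumEdges gainEdge (v ∷ xs) + (c′ + c′))
      ≡⟨ cong₂ _+_ (edge-vote-balance u↝v) (vote-balance l) ⟩
    (lossEdge u v + (d + d)) + (sumEdges lossEdge (v ∷ xs) + (d′ + d′))
      ≡⟨ shuffle (lossEdge u v) _ d d′ ⟨
    (lossEdge u v + sumEdges lossEdge (v ∷ xs)) + ((d + d′) + (d + d′)) ∎
    where
      open ≡-Reasoning
      c = 𝟙 (isMMV I M u v)
      c′ = #MM I M (v ∷ xs)
      d = 𝟙 (isPPV I M u v)
      d′ = #PP I M (v ∷ xs)
      shuffle : ∀ a a′ c c′ → (a + a′) + ((c + c′) + (c + c′)) ≡ (a + (c + c)) + (a′ + (c′ + c′))
      shuffle = solve-∀

  OpenStart : Vertex I → Set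
  OpenStart (inj₁ m) = mateA M m ≡ nothing
  OpenStart (inj₂ _) = ⊤

  OpenEnd : (Fin nA → Bool) → Vertex I → Set
  OpenEnd C (inj₁ m) = C m ≡ false
  OpenEnd C (inj₂ w) = mateB M w ≡ nothing

  -- M ⊕ ℓ for a walk ℓ whose ends may be switched.
  module Switched (C : Fin nA → Bool) {s t ℓ} (walk : Walk _↝_ s t ℓ) (uniq : Unique ℓ)
                  (open-s : OpenStart s) (open-t : OpenEnd C t) where
    open Walk walk

    _∈ℓ? : ∀ v → Dec (v ∈ ℓ)
    v ∈ℓ? = ∈? _≟ᵥ_ v ℓ

    newA : Fin nA → Maybe (Fin nB)
    newA m with inj₁ m ∈ℓ?
    ... | yes _ = asWoman (next _≟ᵥ_ ℓ (inj₁ m))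
    ... | no  _ = mateA M m

    newB : Fin nB → Maybe (Fin nA)
    newB w with inj₂ w ∈ℓ?
    ... | yes _ = asMan (prev _≟ᵥ_ ℓ (inj₂ w))
    ... | no  _ = mateB M w

    newA-off : ∀ {m} → inj₁ m ∉ ℓ → newA m ≡ mateA M m
    newA-off {m} m∉ with inj₁ m ∈ℓ?
    ... | yes m∈ = contradiction m∈ m∉
    ... | no  _  = refl

    newB-off : ∀ {w} → inj₂ w ∉ ℓ → newB w ≡ mateB M w
    newB-off {w} w∉ with inj₂ w ∈ℓ?
    ... | yes w∈ = contradiction w∈ w∉
    ... | no  _  = refl

    newA-at : ∀ pre {m} post → ℓ ≡ pre ++ inj₁ m ∷ post → newA m ≡ asWoman (head post)
    newA-at pre {m} post refl with inj₁ m ∈ℓ?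
    ... | yes _  = cong asWoman (next-at _≟ᵥ_ pre post uniq)
    ... | no m∉ = contradiction (∈-++⁺ʳ pre (here refl)) m∉

    newB-at : ∀ pre {w} post → ℓ ≡ pre ++ inj₂ w ∷ post → newB w ≡ asMan (last pre)
    newB-at pre {w} post refl with inj₂ w ∈ℓ?
    ... | yes _  = cong asMan (prev-at _≟ᵥ_ pre post uniq)
    ... | no w∉ = contradiction (∈-++⁺ʳ pre (here refl)) w∉

    partner-off-walkᴬ : ∀ {m w} → mateA M m ≡ just w → inj₁ m ∉ ℓ → inj₂ w ∉ ℓ
    partner-off-walkᴬ {m} {w} e m∉ w∈ with woman-matched-on-walk walk w∈ w≢t
      where
        w≢t : inj₂ w ≢ t
        w≢t refl = contradiction (trans (sym (mate-sym M m w e)) open-t) λ ()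
    ... | m′ , pair = m∉ (subst (λ x → inj₁ x ∈ ℓ) (partner-unique (proj₁ pair) e) (MatchedPairIn⇒man∈ pair))

    partner-off-walkᴮ : ∀ {m w} → mateB M w ≡ just m → inj₂ w ∉ ℓ → inj₁ m ∉ ℓ
    partner-off-walkᴮ {m} {w} e w∉ m∈ with man-matched-on-walk walk m∈ m≢s
      where
        m≢s : inj₁ m ≢ s
        m≢s refl = contradiction (trans (sym (mate-sym' M m w e)) open-s) λ ()
    ... | w′ , pair =
      w∉ (subst (λ x → inj₂ x ∈ ℓ) (just-injective (trans (sym (proj₁ pair)) (mate-sym' M m w e))) (MatchedPairIn⇒woman∈ pair))

    switched-pair : ∀ pre {m w} post → ℓ ≡ pre ++ inj₁ m ∷ inj₂ w ∷ post → newA m ≡ just w × newB w ≡ just m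
    switched-pair pre {m} {w} post eq =
      newA-at pre (inj₂ w ∷ post) eq ,
      trans (newB-at (pre ∷ʳ inj₁ m) post (trans eq (sym (∷ʳ-++ pre _ _)))) (cong asMan (last-∷ʳ pre _))

    switched-man : ∀ {m w} → newA m ≡ just w → inj₁ m ∈ ℓ →
                   ∃₂ λ pre post → ℓ ≡ pre ++ inj₁ m ∷ inj₂ w ∷ post
    switched-man e m∈ with ∈-∃++ m∈
    ... | pre , post , eq with asWoman-just (trans (sym (newA-at pre post eq)) e)
    ...   | head≡ with post | eq | head≡
    ...     | _ ∷ post′ | eq′ | refl = pre , post′ , eq′

    switched-woman : ∀ {m w} → newB w ≡ just m → inj₂ w ∈ ℓ →
                     ∃₂ λ pre post → ℓ ≡ pre ++ inj₁ m ∷ inj₂ w ∷ post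
    switched-woman e w∈ with ∈-∃++ w∈
    ... | pre , post , eq with last-asMan pre (trans (sym (newB-at pre post eq)) e)
    ...   | pre′ , refl = pre′ , post , trans eq (∷ʳ-++ pre′ _ _)

    newA⇒newB : ∀ m w → newA m ≡ just w → newB w ≡ just m
    newA⇒newB m w e = by-cases (inj₁ m ∈ℓ?)
      where
        by-cases : Dec (inj₁ m ∈ ℓ) → newB w ≡ just m
        by-cases (yes m∈) with switched-man e m∈
        ... | pre , post , eq = proj₂ (switched-pair pre post eq)
        by-cases (no m∉) = trans (newB-off (partner-off-walkᴬ e′ m∉)) (mate-sym M m w e′)
          where e′ = trans (sym (newA-off m∉)) e

    newB⇒newA : ∀ m w → newB w ≡ just m → newA m ≡ just w
    newB⇒newA m w e = by-cases (inj₂ w ∈ℓ?)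
      where
        by-cases : Dec (inj₂ w ∈ ℓ) → newA m ≡ just w
        by-cases (yes w∈) with switched-woman e w∈
        ... | pre , post , eq = proj₁ (switched-pair pre post eq)
        by-cases (no w∉) = trans (newA-off (partner-off-walkᴮ e′ w∉)) (mate-sym' M m w e′)
          where e′ = trans (sym (newB-off w∉)) e

    newA-adj : ∀ m w → newA m ≡ just w → adj m w ≡ true
    newA-adj m w e = by-cases (inj₁ m ∈ℓ?)
      where
        by-cases : Dec (inj₁ m ∈ ℓ) → adj m w ≡ true
        by-cases (yes m∈) with switched-man e m∈
        ... | pre , post , eq = proj₁ (Linked-at pre post (subst (Linked _↝_) eq linked))
        by-cases (no m∉) = mate-adj M m w (trans (sym (newA-off m∉)) e)

    N : Matching I
    N = record { mateA = newA ; mateB = newB ; mate-sym = newA⇒newB ; mate-sym' = newB⇒newA ; mate-adj = newA-adj }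

    N-feasible : Feasible I C M → Feasible I C N
    N-feasible feasible m critical = by-cases (inj₁ m ∈ℓ?)
      where
        by-cases : Dec (inj₁ m ∈ ℓ) → ∃[ w ] newA m ≡ just w
        by-cases (no m∉) with feasible m critical
        ... | w , e = w , trans (newA-off m∉) e
        by-cases (yes m∈) with ∈-∃++ m∈
        ... | pre , inj₂ w ∷ post , eq = w , newA-at pre _ eq
        ... | pre , inj₁ _ ∷ post , eq with () ← Linked-at pre post (subst (Linked _↝_) eq linked)
        ... | pre , [] , eq with refl ← just-injective (trans (sym ends) (trans (cong last eq) (last-∷ʳ pre _))) =
              contradiction (trans (sym critical) open-t) λ ()

    gain loss : Vertex I → Bool
    gain (inj₁ m) = prefA I m (newA m) (mateA M m)
    gain (inj₂ w) = prefB I w (newB w) (mateB M w)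
    loss (inj₁ m) = prefA I m (mateA M m) (newA m)
    loss (inj₂ w) = prefB I w (mateB M w) (newB w)

    gain-off : ∀ v → v ∉ ℓ → gain v ≡ false
    gain-off (inj₁ m) m∉ rewrite newA-off m∉ = prefA-irrefl m (mateA M m)
    gain-off (inj₂ w) w∉ rewrite newB-off w∉ = prefB-irrefl w (mateB M w)

    loss-off : ∀ v → v ∉ ℓ → loss v ≡ false
    loss-off (inj₁ m) m∉ rewrite newA-off m∉ = prefA-irrefl m (mateA M m)
    loss-off (inj₂ w) w∉ rewrite newB-off w∉ = prefB-irrefl w (mateB M w)

    gain-at : ∀ pre v post → ℓ ≡ pre ++ v ∷ post → 𝟙 (gain v) ≡ gainBefore (last pre) v + gainAfter v (head post)
    gain-at pre (inj₁ m) post eq rewrite newA-at pre post eq = refl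
    gain-at pre (inj₂ w) post eq rewrite newB-at pre post eq = sym (+-identityʳ _)

    loss-at : ∀ pre v post → ℓ ≡ pre ++ v ∷ post → 𝟙 (loss v) ≡ lossBefore (last pre) v + lossAfter v (head post)
    loss-at pre (inj₁ m) post eq rewrite newA-at pre post eq = refl
    loss-at pre (inj₂ w) post eq rewrite newB-at pre post eq = sym (+-identityʳ _)

    φ-N-M : φ I N M ≡ sumEdges gainEdge ℓ
    φ-N-M = begin
      φ I N M
        ≡⟨ countV-sum gain uniq gain-off ⟩
      sum (map (𝟙 ∘ gain) ℓ)
        ≡⟨ sum-by-neighbours (𝟙 ∘ gain) gainBefore gainAfter ℓ starts ends gain-at ⟩
      gainBefore nothing s + sumEdges gainEdge ℓ + gainAfter t nothing
        ≡⟨ cong₂ (λ a b → a + sumEdges gainEdge ℓ + b) (no-gain-at-start s) (no-gain-at-end t) ⟩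
      sumEdges gainEdge ℓ + 0
        ≡⟨ +-identityʳ _ ⟩
      sumEdges gainEdge ℓ ∎
      where
        open ≡-Reasoning
        no-gain-at-start : ∀ v → gainBefore nothing v ≡ 0
        no-gain-at-start (inj₁ _) = refl
        no-gain-at-start (inj₂ _) = refl
        no-gain-at-end : ∀ v → gainAfter v nothing ≡ 0
        no-gain-at-end (inj₁ _) = refl
        no-gain-at-end (inj₂ _) = refl

    φ-M-N : φ I M N ≡ lossBefore nothing s + sumEdges lossEdge ℓ + lossAfter t nothing
    φ-M-N = trans (countV-sum loss uniq loss-off) (sum-by-neighbours (𝟙 ∘ loss) lossBefore lossAfter ℓ starts ends loss-at)

  lossAfter≤1 : ∀ v x → lossAfter v x ≤ 1
  lossAfter≤1 (inj₁ m) x = 𝟙≤1 _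
  lossAfter≤1 (inj₂ _) x = z≤n

  lossBefore≤1 : ∀ x v → lossBefore x v ≤ 1
  lossBefore≤1 x (inj₁ _) = z≤n
  lossBefore≤1 x (inj₂ w) = 𝟙≤1 _

  end-losses≤1 : ∀ {s t} → (∃[ m ] s ≡ inj₁ m) ⊎ (∃[ w ] t ≡ inj₂ w) →
                 lossBefore nothing s + lossAfter t nothing ≤ 1
  end-losses≤1 {t = t} (inj₁ (_ , refl)) = lossAfter≤1 t nothing
  end-losses≤1 {s = s} (inj₂ (_ , refl)) = ≤-trans (≤-reflexive (+-identityʳ _)) (lossBefore≤1 nothing s)

  -- Popularity bounds the votes gained by switching M along the walk by the votes lost. Edge by
  -- edge these differ by twice [(+1,+1)] − [(−1,−1)] (vote-balance), and the ends lose at most one vote.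
  popular⇒#PP≤#MM : ∀ {C} → PopularFeasible I C M → ∀ {s t ℓ} → Walk _↝_ s t ℓ → Unique ℓ →
    OpenStart s → OpenEnd C t → (∃[ m ] s ≡ inj₁ m) ⊎ (∃[ w ] t ≡ inj₂ w) → #PP I M ℓ ≤ #MM I M ℓ
  popular⇒#PP≤#MM {C} (feasible , popular) {s} {t} {ℓ} walk uniq open-s open-t exposed-end =
    twice-≤-suc (+-cancelˡ-≤ lost (pp + pp) (suc (mm + mm)) (begin
      lost + (pp + pp)                         ≡⟨ vote-balance (Walk.linked walk) ⟨
      gained + (mm + mm)                       ≤⟨ +-monoˡ-≤ (mm + mm) gained≤lost ⟩
      (at-s + lost + at-t) + (mm + mm)         ≡⟨ regroup at-s lost at-t (mm + mm) ⟩
      lost + ((at-s + at-t) + (mm + mm))       ≤⟨ +-monoʳ-≤ lost (+-monoˡ-≤ (mm + mm) (end-losses≤1 exposed-end)) ⟩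
      lost + suc (mm + mm)                     ∎))
    where
      open Switched C walk uniq open-s open-t
      open ≤-Reasoning
      pp = #PP I M ℓ
      mm = #MM I M ℓ
      gained = sumEdges gainEdge ℓ
      lost = sumEdges lossEdge ℓ
      at-s = lossBefore nothing s
      at-t = lossAfter t nothing
      gained≤lost : gained ≤ at-s + lost + at-t
      gained≤lost = subst₂ _≤_ φ-N-M φ-M-N (popular N (N-feasible feasible))
      regroup : ∀ a b c d → (a + b + c) + d ≡ b + ((a + c) + d)
      regroup = solve-∀

-- The leveling procedure

module Leveling (I : Instance) (M : Matching I) where
  open Instance I
  open Oriented I M

  Balanced : Levels I M → Set
  Balanced L = ∀ m w → mateA M m ≡ just w → L (inj₁ m) ≡ L (inj₂ w)

  _≤ᴸ_ : Levels I M → Levels I M → Set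
  L ≤ᴸ L′ = ∀ v → L v ≤ L′ v

  -- Every step of every phase sets level(w) = level(M(w)) to some k ≥ level(w)
  Raise : Levels I M → Levels I M → Set
  Raise L L′ = ∃[ w ] ∃[ k ] L (inj₂ w) ≤ k × L′ ≡ setLev I M L w k

  touched : Fin nB → Vertex I → Bool
  touched w v = isW I M w v ∨ isPartner I M w v

  touched-partner : ∀ w {m w′} → mateA M m ≡ just w′ → touched w (inj₁ m) ≡ touched w (inj₂ w′)
  touched-partner w {m} {w′} e with w ≟ w′
  ... | yes refl rewrite mate-sym M m w e with m ≟ m
  ...   | yes _  = refl
  ...   | no m≢m = contradiction refl m≢m
  touched-partner w {m} {w′} e | no w≢w′ with mateB M w in e′
  ... | nothing = refl
  ... | just m′ with m ≟ m′
  ...   | yes refl = contradiction (just-injective (trans (sym (mate-sym' M m w e′)) e)) w≢w′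
  ...   | no  _    = refl

  touched-level : ∀ {L} → Balanced L → ∀ w v → touched w v ≡ true → L v ≡ L (inj₂ w)
  touched-level bal w (inj₂ w′) t with w ≟ w′
  ... | yes refl = refl
  touched-level bal w (inj₁ m) t with mateB M w in e
  ... | just m′ with m ≟ m′
  ...   | yes refl = bal m w (mate-sym' M m w e)

  setLev-balanced : ∀ {L} → Balanced L → ∀ w k → Balanced (setLev I M L w k)
  setLev-balanced bal w k m w′ e rewrite touched-partner w e with touched w (inj₂ w′)
  ... | true  = refl
  ... | false = bal m w′ e

  setLev-≥ : ∀ {L} → Balanced L → ∀ w k → L (inj₂ w) ≤ k → L ≤ᴸ setLev I M L w k
  setLev-≥ {L} bal w k le v with touched w v in t
  ... | false = ≤-refl
  ... | true  = ≤-trans (≤-reflexive (touched-level {L} bal w v t)) le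

  raises : ∀ {S : Levels I M → Levels I M → Set} → (∀ {L L′} → S L L′ → Raise L L′) →
           ∀ {L L′} → Star S L L′ → Balanced L → Balanced L′ × L ≤ᴸ L′
  raises step ε         bal = bal , λ _ → ≤-refl
  raises step {L} (s ◅ ss) bal with step s
  ... | w , k , le , refl with raises step ss (setLev-balanced {L} bal w k)
  ...   | bal′ , mono = bal′ , λ v → ≤-trans (setLev-≥ {L} bal w k le v) (mono v)

  step1-raise : ∀ {L L′} → Step1 I M L L′ → Raise L L′
  step1-raise (m , w , (_ , w≤m) , e) = w , _ , m≤n⇒m≤1+n w≤m , e

  step2-raise : ∀ {L L′} → Step2 I M L L′ → Raise L L′
  step2-raise (m , w , (_ , w<m) , e) = w , _ , <⇒≤ w<m , e

  step3-raise : ∀ {L L′} → Step3 I M L L′ → Raise L L′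
  step3-raise {L} (m , w , (_ , w+2≤m) , e) = w , _ , w≤m∸1 , e
    where
      w≤m∸1 : L (inj₂ w) ≤ L (inj₁ m) ∸ 1
      w≤m∸1 = ≤-trans (≤-reflexive (sym (m+n∸n≡m (L (inj₂ w)) 1)))
                      (∸-monoˡ-≤ 1 (≤-trans (+-monoʳ-≤ (L (inj₂ w)) (n≤1+n 1)) w+2≤m))

  round-raises : ∀ {L L′} → Round I M L L′ → Balanced L → Balanced L′ × L ≤ᴸ L′
  round-raises (_ , _ , (s₁ , _) , (s₂ , _) , (s₃ , _)) bal with raises step1-raise s₁ bal
  ... | bal₁ , mono₁ with raises step2-raise s₂ bal₁
  ... | bal₂ , mono₂ with raises step3-raise s₃ bal₂
  ... | bal₃ , mono₃ = bal₃ , λ v → ≤-trans (mono₁ v) (≤-trans (mono₂ v) (mono₃ v))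

  reachable-balanced : ∀ {L} → Star (Round I M) (λ _ → 0) L → Balanced L
  reachable-balanced = go (λ _ _ _ → refl)
    where
      go : ∀ {L L′} → Balanced L → Star (Round I M) L L′ → Balanced L′
      go bal ε        = bal
      go bal (r ◅ rs) = go (proj₁ (round-raises r bal)) rs

  record Stable (L : Levels I M) : Set where
    field
      balanced : Balanced L
      no-app1  : ∀ m w → ¬ App1 I M L m w
      no-app2  : ∀ m w → ¬ App2 I M L m w
      no-app3  : ∀ m w → ¬ App3 I M L m w

  -- A round that changes nothing passes through no intermediate levels, since levels only increase.
  LevelingResult⇒Stable : ∀ {L} → LevelingResult I M L → Stable L
  LevelingResult⇒Stable {L} (reach , (L₁ , L₂ , (s₁ , stop₁) , (s₂ , stop₂) , (s₃ , stop₃))) = record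
    { balanced = bal
    ; no-app1  = λ m w (pp , w≤m) → stop₁ m w (pp , subst₂ _≤_ (L≡L₁ _) (L≡L₁ _) w≤m)
    ; no-app2  = λ m w (mixed , w<m) → stop₂ m w (mixed , subst₂ _<_ (L≡L₂ _) (L≡L₂ _) w<m)
    ; no-app3  = stop₃
    }
    where
      bal = reachable-balanced reach
      r₁ = raises step1-raise s₁ bal
      r₂ = raises step2-raise s₂ (proj₁ r₁)
      r₃ = raises step3-raise s₃ (proj₁ r₂)
      L≡L₁ : ∀ v → L v ≡ L₁ v
      L≡L₁ v = ≤-antisym (proj₂ r₁ v) (≤-trans (proj₂ r₂ v) (proj₂ r₃ v))
      L≡L₂ : ∀ v → L v ≡ L₂ v
      L≡L₂ v = ≤-antisym (≤-trans (proj₂ r₁ v) (proj₂ r₂ v)) (proj₂ r₃ v)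

  module _ {L : Levels I M} (stable : Stable L) where
    open Stable stable

    -- The three phases stop exactly when every unmatched edge (m,w) satisfies
    -- level(m) < level(w), level(m) ≤ level(w), level(m) ≤ level(w) + 1 according to its label.
    step-level : ∀ {u v} → u ↝ v → L u + 𝟙 (isPPV I M u v) ≤ L v + 𝟙 (isMMV I M u v)
    step-level {inj₂ w} {inj₁ m} w↝m rewrite inM-just w↝m = ≤-reflexive (cong (_+ 0) (sym (balanced m w w↝m)))
    step-level {inj₁ m} {inj₂ w} m↝w@(_ , m≁w) rewrite m≁w
      with manPlus I M m w in m+ | womanPlus I M m w in w+
    ... | true  | true  =
          subst₂ _≤_ (+-comm 1 _) (sym (+-identityʳ _)) (≰⇒> λ w≤m → no-app1 m w ((m↝w , m+ , w+) , w≤m))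
    ... | true  | false = +-monoˡ-≤ 0 (≮⇒≥ λ w<m → no-app2 m w ((m↝w , cong₂ _xor_ m+ w+) , w<m))
    ... | false | true  = +-monoˡ-≤ 0 (≮⇒≥ λ w<m → no-app2 m w ((m↝w , cong₂ _xor_ m+ w+) , w<m))
    ... | false | false =
          subst (_≤ L (inj₂ w) + 1) (sym (+-identityʳ _)) (m<1+n⇒m≤n (subst (L (inj₁ m) <_) (+-suc (L (inj₂ w)) 1)
            (≰⇒> λ w+2≤m → no-app3 m w ((m↝w , m+ , w+) , w+2≤m))))

    walk-level : ∀ {u v ℓ} → Walk _↝_ u v ℓ → L u + #PP I M ℓ ≤ L v + #MM I M ℓ
    walk-level {ℓ = x ∷ xs} walk with refl ← just-injective (Walk.starts walk) = go (Walk.linked walk) (Walk.ends walk)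
      where
        go : ∀ {x xs v} → Linked _↝_ (x ∷ xs) → last (x ∷ xs) ≡ just v →
             L x + #PP I M (x ∷ xs) ≤ L v + #MM I M (x ∷ xs)
        go [-]       refl = ≤-refl
        go (x↝y ∷ l) lst  = offset-≤-trans (L _) (L _) (L _) (step-level x↝y) (go l lst)

-- SIAPs and SRAPs

-- Summing the five inequalities and the three equations gives 2 + total ≤ 1 + total.
crossing-arithmetic : ∀ {a a′ b b′ c c′ d d′ e e′ f f′ g g′} l₁ l₂ →
  a + d ≤ a′ + d′ → f + g ≤ f′ + g′ →
  0 + c ≤ l₁ + c′ → l₁ + b ≤ l₂ + b′ → l₂ + e ≤ 1 + e′ →
  a + (b + g) ≡ a′ + (b′ + g′) → c + d ≡ suc (c′ + d′) → f + e ≡ suc (f′ + e′) → ⊥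
crossing-arithmetic {a} {a′} {b} {b′} {c} {c′} {d} {d′} {e} {e′} {f} {f′} {g} {g′} l₁ l₂
  splice₁ splice₂ level₁ level₁₂ level₂ p-even q-surplus₁ q-surplus₂ = 1+n≰n (begin
    suc (suc total)
      ≡⟨ sucs (c′ + d′) (f′ + e′) (a′ + (b′ + g′)) (l₁ + l₂) ⟩
    suc (c′ + d′) + suc (f′ + e′) + (a′ + (b′ + g′)) + (l₁ + l₂)
      ≡⟨ cong₂ (λ u v → u + v + (a′ + (b′ + g′)) + (l₁ + l₂)) q-surplus₁ q-surplus₂ ⟨
    (c + d) + (f + e) + (a′ + (b′ + g′)) + (l₁ + l₂)
      ≡⟨ cong (λ u → (c + d) + (f + e) + u + (l₁ + l₂)) p-even ⟨
    (c + d) + (f + e) + (a + (b + g)) + (l₁ + l₂)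
      ≡⟨ lhs a b c d e f g l₁ l₂ ⟩
    (a + d) + (f + g) + (0 + c) + (l₁ + b) + (l₂ + e)
      ≤⟨ +-mono-≤ (+-mono-≤ (+-mono-≤ (+-mono-≤ splice₁ splice₂) level₁) level₁₂) level₂ ⟩
    (a′ + d′) + (f′ + g′) + (l₁ + c′) + (l₂ + b′) + (1 + e′)
      ≡⟨ rhs a′ b′ c′ d′ e′ f′ g′ l₁ l₂ ⟩
    suc total ∎)
  where
    open ≤-Reasoning
    total = (c′ + d′) + (f′ + e′) + (a′ + (b′ + g′)) + (l₁ + l₂)
    sucs : ∀ x y z w → suc (suc (x + y + z + w)) ≡ suc x + suc y + z + w
    sucs = solve-∀
    lhs : ∀ a b c d e f g l₁ l₂ →
      (c + d) + (f + e) + (a + (b + g)) + (l₁ + l₂) ≡ (a + d) + (f + g) + (0 + c) + (l₁ + b) + (l₂ + e)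
    lhs = solve-∀
    rhs : ∀ a b c d e f g l₁ l₂ →
      (a + d) + (f + g) + (l₁ + c) + (l₂ + b) + (1 + e) ≡ suc ((c + d) + (f + e) + (a + (b + g)) + (l₁ + l₂))
    rhs = solve-∀

module Crossing (I : Instance) (C : Fin (Instance.nA I) → Bool) (M : Matching I) where
  open Instance I
  open Oriented I M
  open Leveling I M

  record AugmentingWalk (ℓ : List (Vertex I)) : Set where
    field
      {man}         : Fin nA
      {woman}       : Fin nB
      walk          : Walk _↝_ (inj₁ man) (inj₂ woman) ℓ
      unique        : Unique ℓ
      man-exposed   : mateA M man ≡ nothing
      woman-exposed : mateB M woman ≡ nothing
      #PP≡#MM       : #PP I M ℓ ≡ #MM I M ℓ

  record ReducingWalk (L : Levels I M) (ℓ : List (Vertex I)) : Set where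
    field
      {woman}         : Fin nB
      {man}           : Fin nA
      walk            : Walk _↝_ (inj₂ woman) (inj₁ man) ℓ
      unique          : Unique ℓ
      woman-level     : L (inj₂ woman) ≡ 0
      man-level       : L (inj₁ man) ≡ 1
      man-noncritical : C man ≡ false
      #PP≡1+#MM       : #PP I M ℓ ≡ suc (#MM I M ℓ)

  SIAP⇒augmenting : ∀ {p} → IsSIAP I M p → ∃[ p′ ] AugmentingWalk p′ × (∀ {v} → v ∈ p → v ∈ p′)
  SIAP⇒augmenting {p} ((alt , uniq) , balanced , _ , _ , man-exp , woman-exp , inj₁ (starts , ends)) =
    p , record
      { walk          = record { linked = linked ; starts = starts ; ends = ends }
      ; unique        = uniq
      ; man-exposed   = man-exp
      ; woman-exposed = woman-exp
      ; #PP≡#MM       = balanced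
      } , id
    where
      linked = Linked-direction (λ ()) starts ends (exposed-man-no-predecessor man-exp) (alternating⇒oriented alt)
  SIAP⇒augmenting {p} ((alt , uniq) , balanced , _ , _ , man-exp , woman-exp , inj₂ (starts , ends)) =
    reverse p , record
      { walk          = Walk-reverse (record { linked = linked ; starts = starts ; ends = ends })
      ; unique        = Unique-reverse uniq
      ; man-exposed   = man-exp
      ; woman-exposed = woman-exp
      ; #PP≡#MM       = trans (countEdges-reverse (isPPV I M) isPPV-sym p)
                          (trans balanced (sym (countEdges-reverse (isMMV I M) isMMV-sym p)))
      } , reverse⁺
    where
      linked = Linked-direction (λ ()) starts ends (exposed-woman-no-successor woman-exp) (swap (alternating⇒oriented alt))

  -- Read backwards, an SRAP would climb from level 1 to level 0 with a surplus of (+1,+1) edges.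
  SRAP⇒reducing : ∀ {L q} → Stable L → IsSRAP I M C L q → ReducingWalk L q
  SRAP⇒reducing {L} {q} stable ((alt , uniq) , surplus , _ , _ , _ , woman-lvl , noncritical , man-lvl , starts , ends) =
    record
      { walk            = record { linked = linked ; starts = starts ; ends = ends }
      ; unique          = uniq
      ; woman-level     = woman-lvl
      ; man-level       = man-lvl
      ; man-noncritical = noncritical
      ; #PP≡1+#MM       = surplus
      }
    where
      linked : Linked _↝_ q
      linked with alternating⇒oriented alt
      ... | inj₁ forward  = forward
      ... | inj₂ backward = contradiction (≤-trans (n≤1+n _) climb) 1+n≰n
        where
          climb : suc (suc (#MM I M q)) ≤ #MM I M q
          climb = subst₂ _≤_
            (cong₂ _+_ man-lvl (trans (countEdges-reverse (isPPV I M) isPPV-sym q) surplus))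
            (cong₂ _+_ woman-lvl (countEdges-reverse (isMMV I M) isMMV-sym q))
            (walk-level stable (Walk-reverse (record { linked = backward ; starts = starts ; ends = ends })))

  module _ (popular : PopularFeasible I C M) {L} (stable : Stable L)
           {p q} (aug : AugmentingWalk p) (red : ReducingWalk L q) where
    private
      module P = AugmentingWalk aug
      module Q = ReducingWalk red

    record FirstCrossing : Set where
      field
        A rest γ δ : List (Vertex I)
        x₁         : Fin nB
        y₁         : Fin nA
        p≡         : p ≡ A ++ inj₂ x₁ ∷ rest
        q≡         : q ≡ γ ++ inj₂ x₁ ∷ inj₁ y₁ ∷ δ
        A∩q≡∅      : All (_∉ q) A

    -- The first vertex of p on q is a woman: a man there has his partner just before him on both
    -- paths (he is not p's exposed first vertex), so she would be an earlier one.
    first-crossing : Any (_∈ q) p → FirstCrossing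
    first-crossing hit with first-split (λ v → ∈? _≟ᵥ_ v q) hit
    ... | A , rest , inj₂ x , p≡ , x∈q , A∩q≡∅ with woman-matched-on-walk Q.walk x∈q (λ ())
    ...   | y , _ , γ , δ , q≡ = record { p≡ = p≡ ; q≡ = q≡ ; A∩q≡∅ = A∩q≡∅ }
    first-crossing hit | A , rest , inj₁ m , p≡ , m∈q , A∩q≡∅ with man-matched-on-walk Q.walk m∈q (λ ())
    ... | x , q-pair@(mate , _)
            with man-predecessor P.walk A rest p≡ (λ { refl → contradiction (trans (sym P.man-exposed) mate) λ () })
    ...   | x′ , mate′ , A′ , refl =
            contradiction (subst (λ z → inj₂ z ∈ q) (just-injective (trans (sym mate) mate′)) (MatchedPairIn⇒woman∈ q-pair))
                          (All.lookup A∩q≡∅ (∈-++⁺ʳ A′ (here refl)))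

    module _ (first : FirstCrossing) where
      open FirstCrossing first

      s : List (Vertex I)
      s = inj₂ x₁ ∷ rest

      p-walk : Walk _↝_ (inj₁ P.man) (inj₂ P.woman) (A ++ s)
      p-walk = subst (Walk _↝_ _ _) p≡ P.walk

      q-walk₁ : Walk _↝_ (inj₂ Q.woman) (inj₁ Q.man) (γ ++ inj₂ x₁ ∷ inj₁ y₁ ∷ δ)
      q-walk₁ = subst (Walk _↝_ _ _) q≡ Q.walk

      s-walk : Walk _↝_ (inj₂ x₁) (inj₂ P.woman) s
      s-walk = proj₂ (Walk-split A rest p-walk)

      s-unique : Unique s
      s-unique = proj₂ (Unique-++⁻ A (subst Unique p≡ P.unique))

      record SecondCrossing : Set where
        field
          α ω γ′ δ′ : List (Vertex I)
          x₂        : Fin nB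
          y₂        : Fin nA
          s≡        : s ≡ α ++ inj₂ x₂ ∷ inj₁ y₂ ∷ ω
          q≡′       : q ≡ γ′ ++ inj₂ x₂ ∷ inj₁ y₂ ∷ δ′
          ω∩q≡∅     : All (_∉ q) ω

      -- The last vertex of s on q is a man: a woman there has her partner just after her on both
      -- paths (she is not p's exposed last vertex), so he would be a later one.
      second-crossing : SecondCrossing
      second-crossing
        with last-split (λ v → ∈? _≟ᵥ_ v q) {s} (here (subst (inj₂ x₁ ∈_) (sym q≡) (∈-++⁺ʳ γ (here refl))))
      ... | α , ω , inj₂ x , s≡ , x∈q , ω∩q≡∅ with woman-matched-on-walk Q.walk x∈q (λ ())
      ...   | y , q-pair@(mate , _)
              with woman-successor s-walk α ω s≡
                     (λ { refl → contradiction (trans (sym P.woman-exposed) (mate-sym M y x mate)) λ () })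
      ...     | y′ , mate′ , ω′ , refl =
                contradiction (subst (λ z → inj₁ z ∈ q) (partner-unique mate mate′) (MatchedPairIn⇒man∈ q-pair))
                              (All.lookup ω∩q≡∅ (here refl))
      second-crossing | α , ω , inj₁ y , s≡ , y∈q , ω∩q≡∅ with man-predecessor s-walk α ω s≡ (λ ())
      ... | x , mate , α′ , refl with man-matched-on-walk Q.walk y∈q (λ ())
      ...   | x′ , mate′ , γ′ , δ′ , q≡′ rewrite just-injective (trans (sym mate′) mate) = record
              { s≡ = trans s≡ (∷ʳ-++ α′ _ _) ; q≡′ = q≡′ ; ω∩q≡∅ = ω∩q≡∅ }

      module _ (second : SecondCrossing) where
        open SecondCrossing second

        pp mm : List (Vertex I) → ℕ
        pp = #PP I M
        mm = #MM I M

        q-walk₂ : Walk _↝_ (inj₂ Q.woman) (inj₁ Q.man) (γ′ ++ inj₂ x₂ ∷ inj₁ y₂ ∷ δ′)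
        q-walk₂ = subst (Walk _↝_ _ _) q≡′ Q.walk

        s-walk′ : Walk _↝_ (inj₂ x₁) (inj₂ P.woman) (α ++ inj₂ x₂ ∷ inj₁ y₂ ∷ ω)
        s-walk′ = subst (Walk _↝_ _ _) s≡ s-walk

        pA pB pG qC qD qF qE : List (Vertex I)
        pA = A ∷ʳ inj₂ x₁
        pB = α ∷ʳ inj₂ x₂
        pG = inj₂ x₂ ∷ inj₁ y₂ ∷ ω
        qC = γ ∷ʳ inj₂ x₁
        qD = inj₂ x₁ ∷ inj₁ y₁ ∷ δ
        qF = γ′ ∷ʳ inj₂ x₂
        qE = inj₂ x₂ ∷ inj₁ y₂ ∷ δ′

        -- The spliced path p[..x₁] q[x₁..], from P.man to Q.man.
        splice₁-bound : pp pA + pp qD ≤ mm pA + mm qD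
        splice₁-bound = subst₂ _≤_ (countEdges-split (isPPV I M) A _) (countEdges-split (isMMV I M) A _)
          (popular⇒#PP≤#MM popular walk unique P.man-exposed Q.man-noncritical (inj₁ (_ , refl)))
          where
            walk = Walk-join A (inj₁ y₁ ∷ δ) (proj₁ (Walk-split A rest p-walk)) (proj₂ (Walk-split γ _ q-walk₁))
            unique = Uniqueₚ.++⁺ (proj₁ (Unique-++⁻ A (subst Unique p≡ P.unique)))
                                 (proj₂ (Unique-++⁻ γ (subst Unique q≡ Q.unique)))
                                 λ (a∈A , a∈q) → All.lookup A∩q≡∅ a∈A (subst (_ ∈_) (sym q≡) (∈-++⁺ʳ γ a∈q))

        -- The spliced path q[..x₂] p[x₂..], from Q.woman to P.woman.
        splice₂-bound : pp qF + pp pG ≤ mm qF + mm pG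
        splice₂-bound = subst₂ _≤_ (countEdges-split (isPPV I M) γ′ _) (countEdges-split (isMMV I M) γ′ _)
          (popular⇒#PP≤#MM popular walk unique tt P.woman-exposed (inj₂ (_ , refl)))
          where
            walk = Walk-join γ′ (inj₁ y₂ ∷ ω) (proj₁ (Walk-split γ′ _ q-walk₂)) (proj₂ (Walk-split α _ s-walk′))
            q≡″ = trans q≡′ (sym (++-assoc γ′ (inj₂ x₂ ∷ inj₁ y₂ ∷ []) δ′))
            s≡″ = trans s≡ (sym (++-assoc α (inj₂ x₂ ∷ inj₁ y₂ ∷ []) ω))
            unique = subst Unique (++-assoc γ′ _ ω)
              (Uniqueₚ.++⁺ (proj₁ (Unique-++⁻ (γ′ ++ _) (subst Unique q≡″ Q.unique)))
                           (proj₂ (Unique-++⁻ (α ++ _) (subst Unique s≡″ s-unique)))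
                           λ (a∈q , a∈ω) → All.lookup ω∩q≡∅ a∈ω (subst (_ ∈_) (sym q≡″) (∈-++⁺ˡ a∈q)))

        split-p : ∀ r → countEdges I M r p ≡ countEdges I M r pA + (countEdges I M r pB + countEdges I M r pG)
        split-p r = trans (cong (countEdges I M r) p≡) (trans (countEdges-split r A rest)
                      (cong (countEdges I M r pA +_) (trans (cong (countEdges I M r) s≡) (countEdges-split r α _))))

        split-q : ∀ pre {x} post → q ≡ pre ++ x ∷ post → ∀ r →
                  countEdges I M r q ≡ countEdges I M r (pre ∷ʳ x) + countEdges I M r (x ∷ post)
        split-q pre post eq r = trans (cong (countEdges I M r) eq) (countEdges-split r pre post)

        p-even : pp pA + (pp pB + pp pG) ≡ mm pA + (mm pB + mm pG)
        p-even = trans (sym (split-p (isPPV I M))) (trans P.#PP≡#MM (split-p (isMMV I M)))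

        q-surplus₁ : pp qC + pp qD ≡ suc (mm qC + mm qD)
        q-surplus₁ = trans (sym (split-q γ _ q≡ (isPPV I M))) (trans Q.#PP≡1+#MM (cong suc (split-q γ _ q≡ (isMMV I M))))

        q-surplus₂ : pp qF + pp qE ≡ suc (mm qF + mm qE)
        q-surplus₂ =
          trans (sym (split-q γ′ _ q≡′ (isPPV I M))) (trans Q.#PP≡1+#MM (cong suc (split-q γ′ _ q≡′ (isMMV I M))))

        level-to-x₁ : 0 + pp qC ≤ L (inj₂ x₁) + mm qC
        level-to-x₁ = subst (λ l → l + pp qC ≤ L (inj₂ x₁) + mm qC) Q.woman-level
          (walk-level stable (proj₁ (Walk-split γ _ q-walk₁)))

        level-x₁-to-x₂ : L (inj₂ x₁) + pp pB ≤ L (inj₂ x₂) + mm pB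
        level-x₁-to-x₂ = walk-level stable (proj₁ (Walk-split α _ s-walk′))

        level-from-x₂ : L (inj₂ x₂) + pp qE ≤ 1 + mm qE
        level-from-x₂ = subst (λ l → L (inj₂ x₂) + pp qE ≤ l + mm qE) Q.man-level
          (walk-level stable (proj₂ (Walk-split γ′ _ q-walk₂)))

        contradiction-at-crossings : ⊥
        contradiction-at-crossings = crossing-arithmetic {pp pA} {mm pA} {f = pp qF} {f′ = mm qF} (L (inj₂ x₁)) (L (inj₂ x₂))
          splice₁-bound splice₂-bound
          level-to-x₁ level-x₁-to-x₂ level-from-x₂ p-even q-surplus₁ q-surplus₂

    no-common-vertex : ∀ {v} → v ∈ p → v ∈ q → ⊥
    no-common-vertex v∈p v∈q = contradiction-at-crossings first (second-crossing first)
      where first = first-crossing (Any.map (λ { refl → v∈q }) v∈p)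

mainTheorem10 : (I : Instance) (C : Fin (Instance.nA I) → Bool) (M : Matching I) →
    PopularFeasible I C M →
    (L : Levels I M) → LevelingResult I M L →
    (v : Vertex I) (p q : List (Vertex I)) →
    IsSIAP I M p → IsSRAP I M C L q → v ∈ p → v ∈ q → ⊥
mainTheorem10 I C M popular L leveled v p q siap srap v∈p v∈q =
  let (_ , augmenting , p⊆p′) = SIAP⇒augmenting siap
  in no-common-vertex popular stable augmenting (SRAP⇒reducing stable srap) (p⊆p′ v∈p) v∈q
  where
    open Leveling I M
    open Crossing I C M
    stable = LevelingResult⇒Stable leveled
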